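{- For all $\lambda$-terms $t, s$: $t \simeq_{\beta_v} s$ iff $t^{v} \simeq_{\mathsf{b}} s^{v}$.
   Context: $\lambda$-terms: $t ::= x \mid \lambda x\,t \mid t\,s$; $\lambda$-values are variables and abstractions; $(\lambda x\,t)\,V \mapsto_{\beta_v} t\{V/x\}$ for $V$ a $\lambda$-value, $\to_{\beta_v}$ its closure under all $\lambda$-contexts $C ::= [\cdot]\mid \lambda x\,C \mid C\,t \mid t\,C$. Bang calculus: terms $T,S ::= x \mid \lambda x\,T \mid T\,S \mid \mathrm{der}\,T \mid {!T}$ (up to $\alpha$-conversion, capture-avoiding substitution); contexts $C ::= [\cdot] \mid \lambda x\,C \mid C\,T \mid T\,C \mid \mathrm{der}\,C \mid {!C}$; root steps $(\lambda x\,T)\,({!S}) \mapsto_{\mathsf{v}} T\{S/x\}$ and $\mathrm{der}\,({!T})\mapsto_{\mathsf{d}} T$; $\to_{\mathsf{b}}$ is the closure of $\mapsto_{\mathsf{v}}\cup\mapsto_{\mathsf{d}}$ under contexts. $\simeq_{\mathsf{r}}$ denotes the reflexive, symmetric, transitive closure of $\to_{\mathsf{r}}$. CbV translation: $x^{v} = {!x}$, $(\lambda x\,t)^{v} = {!(\lambda x\,t^{v})}$, $(t\,s)^{v} = (\mathrm{der}\,t^{v})\,s^{v}$. -}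

module Defs where

open import Data.Nat using (ℕ; zero; suc)
open import Data.Fin using (Fin; zero; suc)
open import Relation.Binary.Construct.Closure.Equivalence using (EqClosure)

-- Terms are represented with well-scoped de Bruijn indices: a term in
-- 'Λ n' has its free variables among 'Fin n'.  This represents terms up to
-- α-conversion; substitution below is capture-avoiding by construction.

data Λ (n : ℕ) : Set where
  var : Fin n → Λ n
  lam : Λ (suc n) → Λ n
  app : Λ n → Λ n → Λ n

extR : ∀ {m n} → (Fin m → Fin n) → Fin (suc m) → Fin (suc n)
extR ρ zero    = zero
extR ρ (suc i) = suc (ρ i)

renΛ : ∀ {m n} → (Fin m → Fin n) → Λ m → Λ n
renΛ ρ (var i)   = var (ρ i)
renΛ ρ (lam t)   = lam (renΛ (extR ρ) t)
renΛ ρ (app t s) = app (renΛ ρ t) (renΛ ρ s)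

extsΛ : ∀ {m n} → (Fin m → Λ n) → Fin (suc m) → Λ (suc n)
extsΛ σ zero    = var zero
extsΛ σ (suc i) = renΛ suc (σ i)

subΛ : ∀ {m n} → (Fin m → Λ n) → Λ m → Λ n
subΛ σ (var i)   = σ i
subΛ σ (lam t)   = lam (subΛ (extsΛ σ) t)
subΛ σ (app t s) = app (subΛ σ t) (subΛ σ s)

singleΛ : ∀ {n} → Λ n → Fin (suc n) → Λ n
singleΛ s zero    = s
singleΛ s (suc i) = var i

_[_]Λ : ∀ {n} → Λ (suc n) → Λ n → Λ n
t [ s ]Λ = subΛ (singleΛ s) t

data ValueΛ {n : ℕ} : Λ n → Set where
  v-var : ∀ {i} → ValueΛ (var i)
  v-lam : ∀ {t} → ValueΛ (lam t)

data _→βv_ {n : ℕ} : Λ n → Λ n → Set where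
  βv   : ∀ {t V} → ValueΛ V → app (lam t) V →βv (t [ V ]Λ)
  ξlam : ∀ {t t'} → _→βv_ {suc n} t t' → lam t →βv lam t'
  ξl   : ∀ {t t' s} → t →βv t' → app t s →βv app t' s
  ξr   : ∀ {t s s'} → s →βv s' → app t s →βv app t s'

_≃βv_ : ∀ {n} → Λ n → Λ n → Set
_≃βv_ = EqClosure _→βv_

data Bang (n : ℕ) : Set where
  var : Fin n → Bang n
  lam : Bang (suc n) → Bang n
  app : Bang n → Bang n → Bang n
  der : Bang n → Bang n
  !_  : Bang n → Bang n

renB : ∀ {m n} → (Fin m → Fin n) → Bang m → Bang n
renB ρ (var i)   = var (ρ i)
renB ρ (lam t)   = lam (renB (extR ρ) t)
renB ρ (app t s) = app (renB ρ t) (renB ρ s)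
renB ρ (der t)   = der (renB ρ t)
renB ρ (! t)     = ! (renB ρ t)

extsB : ∀ {m n} → (Fin m → Bang n) → Fin (suc m) → Bang (suc n)
extsB σ zero    = var zero
extsB σ (suc i) = renB suc (σ i)

subB : ∀ {m n} → (Fin m → Bang n) → Bang m → Bang n
subB σ (var i)   = σ i
subB σ (lam t)   = lam (subB (extsB σ) t)
subB σ (app t s) = app (subB σ t) (subB σ s)
subB σ (der t)   = der (subB σ t)
subB σ (! t)     = ! (subB σ t)

singleB : ∀ {n} → Bang n → Fin (suc n) → Bang n
singleB s zero    = s
singleB s (suc i) = var i

_[_]B : ∀ {n} → Bang (suc n) → Bang n → Bang n
t [ s ]B = subB (singleB s) t

data _→b_ {n : ℕ} : Bang n → Bang n → Set where
  βv   : ∀ {T S} → app (lam T) (! S) →b (T [ S ]B)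
  βd   : ∀ {T} → der (! T) →b T
  ξlam : ∀ {T T'} → _→b_ {suc n} T T' → lam T →b lam T'
  ξl   : ∀ {T T' S} → T →b T' → app T S →b app T' S
  ξr   : ∀ {T S S'} → S →b S' → app T S →b app T S'
  ξder : ∀ {T T'} → T →b T' → der T →b der T'
  ξ!   : ∀ {T T'} → T →b T' → (! T) →b (! T')

_≃b_ : ∀ {n} → Bang n → Bang n → Set
_≃b_ = EqClosure _→b_

_ᵛ : ∀ {n} → Λ n → Bang n
var i ᵛ   = ! var i
lam t ᵛ   = ! lam (t ᵛ)
app t s ᵛ = app (der (t ᵛ)) (s ᵛ)

-- A βv-step (λx t) V becomes, after translation, a d-step that unboxes the
-- function followed by a v-step: a value V translates to a box !S, and
-- substituting S in tᵛ yields the translation of t{V/x}.  Conversely,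
-- erasing der and ! turns b-reductions of terms in which ! only guards values
-- (a class containing all translations and closed under →b) into
-- βv-conversions.  Since →b is confluent (Tait–Martin-Löf parallel
-- reduction), a b-conversion between two translations yields a common
-- reduct, and erasing both reductions gives the βv-conversion.
module Submission where

open import Defs
open import Data.Nat using (ℕ; zero; suc)
open import Data.Fin using (Fin; zero; suc)
open import Data.Product using (∃; _×_; _,_)
open import Function.Bundles using (_⇔_; mk⇔)
open import Level using (Level)
open import Relation.Binary.Core using (Rel; _⇒_)
open import Relation.Binary.PropositionalEquality
open import Relation.Binary.Rewriting using (Confluent)
open import Relation.Binary.Construct.Closure.ReflexiveTransitive as Star
  using (Star; ε; _◅_; _◅◅_; _⋆)
open import Relation.Binary.Construct.Closure.Symmetric using (fwd; bwd)
open import Relation.Binary.Construct.Closure.Equivalence as EqClosure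
  using (EqClosure)
open import Relation.Binary.Construct.Closure.Equivalence.Properties
  using (a—↠b⇒a↔b)

-- Abstract rewriting

module _ {a ℓ : Level} {A : Set a} {_⟶_ : Rel A ℓ} where

  private
    _—↠_ = Star _⟶_

  diamond⇒confluent :
    (∀ {x y z} → x ⟶ y → x ⟶ z → ∃ λ w → (y ⟶ w) × (z ⟶ w)) → Confluent _⟶_
  diamond⇒confluent diamond = confluent
    where
    strip : ∀ {x y z} → x ⟶ y → x —↠ z → ∃ λ w → (y —↠ w) × (z ⟶ w)
    strip x⟶y ε = _ , ε , x⟶y
    strip x⟶y (x⟶z ◅ z↠z') with diamond x⟶y x⟶z
    ... | w , y⟶w , z⟶w with strip z⟶w z↠z'
    ...   | w' , w↠w' , z'⟶w' = w' , y⟶w ◅ w↠w' , z'⟶w'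

    confluent : Confluent _⟶_
    confluent ε x↠z = _ , x↠z , ε
    confluent (x⟶y ◅ y↠y') x↠z with strip x⟶y x↠z
    ... | w , y↠w , z⟶w with confluent y↠y' y↠w
    ...   | w' , y'↠w' , w↠w' = w' , y'↠w' , z⟶w ◅ w↠w'

  confluent⇒church-rosser : Confluent _⟶_ →
    ∀ {x y} → EqClosure _⟶_ x y → ∃ λ z → (x —↠ z) × (y —↠ z)
  confluent⇒church-rosser conf ε = _ , ε , ε
  confluent⇒church-rosser conf (fwd x⟶x' ◅ x'↔y) with confluent⇒church-rosser conf x'↔y
  ... | z , x'↠z , y↠z = z , x⟶x' ◅ x'↠z , y↠z
  confluent⇒church-rosser conf (bwd x'⟶x ◅ x'↔y) with confluent⇒church-rosser conf x'↔y
  ... | z , x'↠z , y↠z with conf (x'⟶x ◅ ε) x'↠z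
  ...   | w , x↠w , z↠w = w , x↠w , y↠z ◅◅ z↠w

  confluent-by-sandwich : ∀ {ℓ'} {_⇛_ : Rel A ℓ'} →
    _⟶_ ⇒ _⇛_ → _⇛_ ⇒ Star _⟶_ → Confluent _⇛_ → Confluent _⟶_
  confluent-by-sandwich ⟶⊆⇛ ⇛⊆↠ conf x↠y x↠z
    with conf (Star.map ⟶⊆⇛ x↠y) (Star.map ⟶⊆⇛ x↠z)
  ... | w , y⇛*w , z⇛*w = w , (⇛⊆↠ ⋆) y⇛*w , (⇛⊆↠ ⋆) z⇛*w

infix 4 _→b*_

_→b*_ : ∀ {n} → Bang n → Bang n → Set
_→b*_ = Star _→b_

extR-cong : ∀ {m n} {ρ ρ' : Fin m → Fin n} → (∀ i → ρ i ≡ ρ' i) →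
            ∀ i → extR ρ i ≡ extR ρ' i
extR-cong h zero    = refl
extR-cong h (suc i) = cong suc (h i)

renB-cong : ∀ {m n} {ρ ρ' : Fin m → Fin n} → (∀ i → ρ i ≡ ρ' i) →
            ∀ T → renB ρ T ≡ renB ρ' T
renB-cong h (var i)   = cong var (h i)
renB-cong h (lam T)   = cong lam (renB-cong (extR-cong h) T)
renB-cong h (app T S) = cong₂ app (renB-cong h T) (renB-cong h S)
renB-cong h (der T)   = cong der (renB-cong h T)
renB-cong h (! T)     = cong !_ (renB-cong h T)

extsB-cong : ∀ {m n} {σ σ' : Fin m → Bang n} → (∀ i → σ i ≡ σ' i) →
             ∀ i → extsB σ i ≡ extsB σ' i
extsB-cong h zero    = refl
extsB-cong h (suc i) = cong (renB suc) (h i)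

subB-cong : ∀ {m n} {σ σ' : Fin m → Bang n} → (∀ i → σ i ≡ σ' i) →
            ∀ T → subB σ T ≡ subB σ' T
subB-cong h (var i)   = h i
subB-cong h (lam T)   = cong lam (subB-cong (extsB-cong h) T)
subB-cong h (app T S) = cong₂ app (subB-cong h T) (subB-cong h S)
subB-cong h (der T)   = cong der (subB-cong h T)
subB-cong h (! T)     = cong !_ (subB-cong h T)

renB-renB : ∀ {k m n} (ρ : Fin m → Fin n) (ρ' : Fin k → Fin m) T →
            renB ρ (renB ρ' T) ≡ renB (λ i → ρ (ρ' i)) T
renB-renB ρ ρ' (var i)   = refl
renB-renB ρ ρ' (lam T)   = cong lam (trans (renB-renB (extR ρ) (extR ρ') T)
                                      (renB-cong (λ { zero → refl ; (suc i) → refl }) T))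
renB-renB ρ ρ' (app T S) = cong₂ app (renB-renB ρ ρ' T) (renB-renB ρ ρ' S)
renB-renB ρ ρ' (der T)   = cong der (renB-renB ρ ρ' T)
renB-renB ρ ρ' (! T)     = cong !_ (renB-renB ρ ρ' T)

subB-renB : ∀ {k m n} (σ : Fin m → Bang n) (ρ : Fin k → Fin m) T →
            subB σ (renB ρ T) ≡ subB (λ i → σ (ρ i)) T
subB-renB σ ρ (var i)   = refl
subB-renB σ ρ (lam T)   = cong lam (trans (subB-renB (extsB σ) (extR ρ) T)
                                      (subB-cong (λ { zero → refl ; (suc i) → refl }) T))
subB-renB σ ρ (app T S) = cong₂ app (subB-renB σ ρ T) (subB-renB σ ρ S)
subB-renB σ ρ (der T)   = cong der (subB-renB σ ρ T)
subB-renB σ ρ (! T)     = cong !_ (subB-renB σ ρ T)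

renB-subB : ∀ {k m n} (ρ : Fin m → Fin n) (σ : Fin k → Bang m) T →
            renB ρ (subB σ T) ≡ subB (λ i → renB ρ (σ i)) T
renB-subB ρ σ (var i)   = refl
renB-subB ρ σ (lam T)   = cong lam (trans (renB-subB (extR ρ) (extsB σ) T) (subB-cong extsB-renB T))
  where
  extsB-renB : ∀ i → renB (extR ρ) (extsB σ i) ≡ extsB (λ j → renB ρ (σ j)) i
  extsB-renB zero    = refl
  extsB-renB (suc i) = trans (renB-renB (extR ρ) suc (σ i)) (sym (renB-renB suc ρ (σ i)))
renB-subB ρ σ (app T S) = cong₂ app (renB-subB ρ σ T) (renB-subB ρ σ S)
renB-subB ρ σ (der T)   = cong der (renB-subB ρ σ T)
renB-subB ρ σ (! T)     = cong !_ (renB-subB ρ σ T)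

subB-subB : ∀ {k m n} (σ : Fin m → Bang n) (τ : Fin k → Bang m) T →
            subB σ (subB τ T) ≡ subB (λ i → subB σ (τ i)) T
subB-subB σ τ (var i)   = refl
subB-subB σ τ (lam T)   = cong lam (trans (subB-subB (extsB σ) (extsB τ) T) (subB-cong extsB-subB T))
  where
  extsB-subB : ∀ i → subB (extsB σ) (extsB τ i) ≡ extsB (λ j → subB σ (τ j)) i
  extsB-subB zero    = refl
  extsB-subB (suc i) = trans (subB-renB (extsB σ) suc (τ i)) (sym (renB-subB suc σ (τ i)))
subB-subB σ τ (app T S) = cong₂ app (subB-subB σ τ T) (subB-subB σ τ S)
subB-subB σ τ (der T)   = cong der (subB-subB σ τ T)
subB-subB σ τ (! T)     = cong !_ (subB-subB σ τ T)

subB-var : ∀ {n} (T : Bang n) → subB var T ≡ T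
subB-var (var i)   = refl
subB-var (lam T)   = cong lam (trans (subB-cong (λ { zero → refl ; (suc i) → refl }) T) (subB-var T))
subB-var (app T S) = cong₂ app (subB-var T) (subB-var S)
subB-var (der T)   = cong der (subB-var T)
subB-var (! T)     = cong !_ (subB-var T)

subB-[]B : ∀ {m n} (σ : Fin m → Bang n) T S →
           subB (extsB σ) T [ subB σ S ]B ≡ subB σ (T [ S ]B)
subB-[]B σ T S = begin
  subB (singleB (subB σ S)) (subB (extsB σ) T)       ≡⟨ subB-subB _ _ T ⟩
  subB (λ i → subB (singleB (subB σ S)) (extsB σ i)) T ≡⟨ subB-cong single-extsB T ⟩
  subB (λ i → subB σ (singleB S i)) T                 ≡⟨ subB-subB σ (singleB S) T ⟨
  subB σ (T [ S ]B)                                   ∎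
  where
  open ≡-Reasoning
  single-extsB : ∀ i → subB (singleB (subB σ S)) (extsB σ i) ≡ subB σ (singleB S i)
  single-extsB zero    = refl
  single-extsB (suc i) = trans (subB-renB _ suc (σ i)) (subB-var (σ i))

renB-[]B : ∀ {m n} (ρ : Fin m → Fin n) T S →
           renB (extR ρ) T [ renB ρ S ]B ≡ renB ρ (T [ S ]B)
renB-[]B ρ T S = trans (subB-renB _ _ T)
  (trans (subB-cong (λ { zero → refl ; (suc i) → refl }) T) (sym (renB-subB ρ (singleB S) T)))

-- The translation simulates βv-reduction

renB-ᵛ : ∀ {m n} (ρ : Fin m → Fin n) t → renB ρ (t ᵛ) ≡ renΛ ρ t ᵛ
renB-ᵛ ρ (var i)   = refl
renB-ᵛ ρ (lam t)   = cong (λ T → ! lam T) (renB-ᵛ (extR ρ) t)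
renB-ᵛ ρ (app t s) = cong₂ (λ T S → app (der T) S) (renB-ᵛ ρ t) (renB-ᵛ ρ s)

subB-ᵛ : ∀ {m n} (σ' : Fin m → Bang n) (σ : Fin m → Λ n) → (∀ i → ! σ' i ≡ σ i ᵛ) →
         ∀ t → subB σ' (t ᵛ) ≡ subΛ σ t ᵛ
subB-ᵛ σ' σ h (var i)   = h i
subB-ᵛ σ' σ h (lam t)   = cong (λ T → ! lam T) (subB-ᵛ (extsB σ') (extsΛ σ) extsB-ᵛ t)
  where
  extsB-ᵛ : ∀ i → ! extsB σ' i ≡ extsΛ σ i ᵛ
  extsB-ᵛ zero    = refl
  extsB-ᵛ (suc i) = trans (cong (renB suc) (h i)) (renB-ᵛ suc (σ i))
subB-ᵛ σ' σ h (app t s) = cong₂ (λ T S → app (der T) S) (subB-ᵛ σ' σ h t) (subB-ᵛ σ' σ h s)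

βvᵛ : ∀ {n} (t : Λ (suc n)) {V : Λ n} {S : Bang n} → V ᵛ ≡ ! S →
      (app (lam t) V ᵛ) →b* (t [ V ]Λ ᵛ)
βvᵛ t {V} {S} Vᵛ≡!S rewrite Vᵛ≡!S =
  subst (app (der (! lam (t ᵛ))) (! S) →b*_) (subB-ᵛ _ _ single-ᵛ t) (ξl βd ◅ βv ◅ ε)
  where
  single-ᵛ : ∀ i → ! singleB S i ≡ singleΛ V i ᵛ
  single-ᵛ zero    = sym Vᵛ≡!S
  single-ᵛ (suc i) = refl

ᵛ-preserves-→βv : ∀ {n} {t s : Λ n} → t →βv s → (t ᵛ) ≃b (s ᵛ)
ᵛ-preserves-→βv (βv {t = t} v-var) = a—↠b⇒a↔b (βvᵛ t refl)
ᵛ-preserves-→βv (βv {t = t} v-lam) = a—↠b⇒a↔b (βvᵛ t refl)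
ᵛ-preserves-→βv (ξlam r) = EqClosure.gmap (λ T → ! lam T) (λ r → ξ! (ξlam r)) (ᵛ-preserves-→βv r)
ᵛ-preserves-→βv (ξl r)   = EqClosure.gmap (λ T → app (der T) _) (λ r → ξl (ξder r)) (ᵛ-preserves-→βv r)
ᵛ-preserves-→βv (ξr r)   = EqClosure.gmap (app _) ξr (ᵛ-preserves-→βv r)

ᵛ-preserves-≃βv : ∀ {n} {t s : Λ n} → t ≃βv s → (t ᵛ) ≃b (s ᵛ)
ᵛ-preserves-≃βv = EqClosure.gfold (EqClosure.isEquivalence _→b_) _ᵛ ᵛ-preserves-→βv

-- Confluence of the bang calculus

infix 4 _⇛_

data _⇛_ {n : ℕ} : Bang n → Bang n → Set where
  var : ∀ {i} → var i ⇛ var i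
  lam : ∀ {T T'} → _⇛_ {suc n} T T' → lam T ⇛ lam T'
  app : ∀ {T T' S S'} → T ⇛ T' → S ⇛ S' → app T S ⇛ app T' S'
  der : ∀ {T T'} → T ⇛ T' → der T ⇛ der T'
  !_  : ∀ {T T'} → T ⇛ T' → (! T) ⇛ (! T')
  βv  : ∀ {T T' S S'} → _⇛_ {suc n} T T' → S ⇛ S' → app (lam T) (! S) ⇛ T' [ S' ]B
  βd  : ∀ {T T'} → T ⇛ T' → der (! T) ⇛ T'

⇛-refl : ∀ {n} (T : Bang n) → T ⇛ T
⇛-refl (var i)   = var
⇛-refl (lam T)   = lam (⇛-refl T)
⇛-refl (app T S) = app (⇛-refl T) (⇛-refl S)
⇛-refl (der T)   = der (⇛-refl T)
⇛-refl (! T)     = ! ⇛-refl T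

⇛-renB : ∀ {m n} (ρ : Fin m → Fin n) {T T'} → T ⇛ T' → renB ρ T ⇛ renB ρ T'
⇛-renB ρ var       = var
⇛-renB ρ (lam p)   = lam (⇛-renB (extR ρ) p)
⇛-renB ρ (app p q) = app (⇛-renB ρ p) (⇛-renB ρ q)
⇛-renB ρ (der p)   = der (⇛-renB ρ p)
⇛-renB ρ (! p)     = ! ⇛-renB ρ p
⇛-renB ρ (βv {T' = T'} {S' = S'} p q) =
  subst (_ ⇛_) (renB-[]B ρ T' S') (βv (⇛-renB (extR ρ) p) (⇛-renB ρ q))
⇛-renB ρ (βd p)    = βd (⇛-renB ρ p)

⇛-extsB : ∀ {m n} {σ σ' : Fin m → Bang n} → (∀ i → σ i ⇛ σ' i) → ∀ i → extsB σ i ⇛ extsB σ' i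
⇛-extsB h zero    = var
⇛-extsB h (suc i) = ⇛-renB suc (h i)

⇛-subB : ∀ {m n} {σ σ' : Fin m → Bang n} → (∀ i → σ i ⇛ σ' i) →
         ∀ {T T'} → T ⇛ T' → subB σ T ⇛ subB σ' T'
⇛-subB h var       = h _
⇛-subB h (lam p)   = lam (⇛-subB (⇛-extsB h) p)
⇛-subB h (app p q) = app (⇛-subB h p) (⇛-subB h q)
⇛-subB h (der p)   = der (⇛-subB h p)
⇛-subB h (! p)     = ! ⇛-subB h p
⇛-subB {σ' = σ'} h (βv {T' = T'} {S' = S'} p q) =
  subst (_ ⇛_) (subB-[]B σ' T' S') (βv (⇛-subB (⇛-extsB h) p) (⇛-subB h q))
⇛-subB h (βd p)    = βd (⇛-subB h p)

⇛-[]B : ∀ {n} {T T' : Bang (suc n)} {S S'} → T ⇛ T' → S ⇛ S' → T [ S ]B ⇛ T' [ S' ]B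
⇛-[]B p q = ⇛-subB (λ { zero → q ; (suc i) → var }) p

⇛-diamond : ∀ {n} {T T₁ T₂ : Bang n} → T ⇛ T₁ → T ⇛ T₂ → ∃ λ U → (T₁ ⇛ U) × (T₂ ⇛ U)
⇛-diamond var var = _ , var , var
⇛-diamond (lam p) (lam q) with ⇛-diamond p q
... | U , p' , q' = lam U , lam p' , lam q'
⇛-diamond (app p₁ p₂) (app q₁ q₂) with ⇛-diamond p₁ q₁ | ⇛-diamond p₂ q₂
... | U , p₁' , q₁' | V , p₂' , q₂' = app U V , app p₁' p₂' , app q₁' q₂'
⇛-diamond (app (lam p₁) (! p₂)) (βv q₁ q₂) with ⇛-diamond p₁ q₁ | ⇛-diamond p₂ q₂
... | U , p₁' , q₁' | V , p₂' , q₂' = U [ V ]B , βv p₁' p₂' , ⇛-[]B q₁' q₂'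
⇛-diamond (βv p₁ p₂) (app (lam q₁) (! q₂)) with ⇛-diamond p₁ q₁ | ⇛-diamond p₂ q₂
... | U , p₁' , q₁' | V , p₂' , q₂' = U [ V ]B , ⇛-[]B p₁' p₂' , βv q₁' q₂'
⇛-diamond (βv p₁ p₂) (βv q₁ q₂) with ⇛-diamond p₁ q₁ | ⇛-diamond p₂ q₂
... | U , p₁' , q₁' | V , p₂' , q₂' = U [ V ]B , ⇛-[]B p₁' p₂' , ⇛-[]B q₁' q₂'
⇛-diamond (der p) (der q) with ⇛-diamond p q
... | U , p' , q' = der U , der p' , der q'
⇛-diamond (der (! p)) (βd q) with ⇛-diamond p q
... | U , p' , q' = U , βd p' , q'
⇛-diamond (βd p) (der (! q)) with ⇛-diamond p q
... | U , p' , q' = U , p' , βd q'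
⇛-diamond (βd p) (βd q) = ⇛-diamond p q
⇛-diamond (! p) (! q) with ⇛-diamond p q
... | U , p' , q' = ! U , ! p' , ! q'

→b⇒⇛ : ∀ {n} {T T' : Bang n} → T →b T' → T ⇛ T'
→b⇒⇛ βv       = βv (⇛-refl _) (⇛-refl _)
→b⇒⇛ βd       = βd (⇛-refl _)
→b⇒⇛ (ξlam r) = lam (→b⇒⇛ r)
→b⇒⇛ (ξl r)   = app (→b⇒⇛ r) (⇛-refl _)
→b⇒⇛ (ξr r)   = app (⇛-refl _) (→b⇒⇛ r)
→b⇒⇛ (ξder r) = der (→b⇒⇛ r)
→b⇒⇛ (ξ! r)   = ! →b⇒⇛ r

⇛⇒→b* : ∀ {n} {T T' : Bang n} → T ⇛ T' → T →b* T'
⇛⇒→b* var       = ε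
⇛⇒→b* (lam p)   = Star.gmap lam ξlam (⇛⇒→b* p)
⇛⇒→b* (app p q) = Star.gmap (λ T → app T _) ξl (⇛⇒→b* p) ◅◅ Star.gmap (app _) ξr (⇛⇒→b* q)
⇛⇒→b* (der p)   = Star.gmap der ξder (⇛⇒→b* p)
⇛⇒→b* (! p)     = Star.gmap !_ ξ! (⇛⇒→b* p)
⇛⇒→b* (βv p q)  = Star.gmap (λ T → app (lam T) _) (λ r → ξl (ξlam r)) (⇛⇒→b* p)
               ◅◅ Star.gmap (λ S → app _ (! S)) (λ r → ξr (ξ! r)) (⇛⇒→b* q)
               ◅◅ βv ◅ ε
⇛⇒→b* (βd p)    = Star.gmap (λ T → der (! T)) (λ r → ξder (ξ! r)) (⇛⇒→b* p) ◅◅ βd ◅ ε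

→b-confluent : ∀ {n} → Confluent (_→b_ {n})
→b-confluent = confluent-by-sandwich →b⇒⇛ ⇛⇒→b* (diamond⇒confluent ⇛-diamond)

-- Erasure reflects b-reduction of translated terms

erase : ∀ {n} → Bang n → Λ n
erase (var i)   = var i
erase (lam T)   = lam (erase T)
erase (app T S) = app (erase T) (erase S)
erase (der T)   = erase T
erase (! T)     = erase T

erase-ᵛ : ∀ {n} (t : Λ n) → erase (t ᵛ) ≡ t
erase-ᵛ (var i)   = refl
erase-ᵛ (lam t)   = cong lam (erase-ᵛ t)
erase-ᵛ (app t s) = cong₂ app (erase-ᵛ t) (erase-ᵛ s)

subΛ-cong : ∀ {m n} {σ σ' : Fin m → Λ n} → (∀ i → σ i ≡ σ' i) → ∀ t → subΛ σ t ≡ subΛ σ' t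
subΛ-cong h (var i)   = h i
subΛ-cong h (lam t)   = cong lam (subΛ-cong extsΛ-cong t)
  where
  extsΛ-cong : ∀ i → extsΛ _ i ≡ extsΛ _ i
  extsΛ-cong zero    = refl
  extsΛ-cong (suc i) = cong (renΛ suc) (h i)
subΛ-cong h (app t s) = cong₂ app (subΛ-cong h t) (subΛ-cong h s)

erase-renB : ∀ {m n} (ρ : Fin m → Fin n) T → erase (renB ρ T) ≡ renΛ ρ (erase T)
erase-renB ρ (var i)   = refl
erase-renB ρ (lam T)   = cong lam (erase-renB (extR ρ) T)
erase-renB ρ (app T S) = cong₂ app (erase-renB ρ T) (erase-renB ρ S)
erase-renB ρ (der T)   = erase-renB ρ T
erase-renB ρ (! T)     = erase-renB ρ T

erase-subB : ∀ {m n} (σ : Fin m → Bang n) T →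
             erase (subB σ T) ≡ subΛ (λ i → erase (σ i)) (erase T)
erase-subB σ (var i)   = refl
erase-subB σ (lam T)   = cong lam (trans (erase-subB (extsB σ) T) (subΛ-cong erase-extsB (erase T)))
  where
  erase-extsB : ∀ i → erase (extsB σ i) ≡ extsΛ (λ j → erase (σ j)) i
  erase-extsB zero    = refl
  erase-extsB (suc i) = erase-renB suc (σ i)
erase-subB σ (app T S) = cong₂ app (erase-subB σ T) (erase-subB σ S)
erase-subB σ (der T)   = erase-subB σ T
erase-subB σ (! T)     = erase-subB σ T

erase-[]B : ∀ {n} (T : Bang (suc n)) S → erase (T [ S ]B) ≡ erase T [ erase S ]Λ
erase-[]B T S = trans (erase-subB _ T) (subΛ-cong (λ { zero → refl ; (suc i) → refl }) (erase T))

mutual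
  data CbV {n : ℕ} : Bang n → Set where
    var : ∀ {i} → CbV (var i)
    lam : ∀ {T} → CbV {suc n} T → CbV (lam T)
    app : ∀ {T S} → CbV T → CbV S → CbV (app T S)
    der : ∀ {T} → CbV T → CbV (der T)
    !_  : ∀ {T} → CbVValue T → CbV (! T)

  data CbVValue {n : ℕ} : Bang n → Set where
    var : ∀ {i} → CbVValue (var i)
    lam : ∀ {T} → CbV {suc n} T → CbVValue (lam T)

CbV-ᵛ : ∀ {n} (t : Λ n) → CbV (t ᵛ)
CbV-ᵛ (var i)   = ! var
CbV-ᵛ (lam t)   = ! lam (CbV-ᵛ t)
CbV-ᵛ (app t s) = app (der (CbV-ᵛ t)) (CbV-ᵛ s)

CbVValue⇒CbV : ∀ {n} {T : Bang n} → CbVValue T → CbV T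
CbVValue⇒CbV var     = var
CbVValue⇒CbV (lam c) = lam c

erase-CbVValue : ∀ {n} {T : Bang n} → CbVValue T → ValueΛ (erase T)
erase-CbVValue var     = v-var
erase-CbVValue (lam c) = v-lam

mutual
  CbV-renB : ∀ {m n} (ρ : Fin m → Fin n) {T} → CbV T → CbV (renB ρ T)
  CbV-renB ρ var       = var
  CbV-renB ρ (lam c)   = lam (CbV-renB (extR ρ) c)
  CbV-renB ρ (app c d) = app (CbV-renB ρ c) (CbV-renB ρ d)
  CbV-renB ρ (der c)   = der (CbV-renB ρ c)
  CbV-renB ρ (! v)     = ! CbVValue-renB ρ v

  CbVValue-renB : ∀ {m n} (ρ : Fin m → Fin n) {T} → CbVValue T → CbVValue (renB ρ T)
  CbVValue-renB ρ var     = var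
  CbVValue-renB ρ (lam c) = lam (CbV-renB (extR ρ) c)

CbVValue-extsB : ∀ {m n} {σ : Fin m → Bang n} → (∀ i → CbVValue (σ i)) →
                 ∀ i → CbVValue (extsB σ i)
CbVValue-extsB h zero    = var
CbVValue-extsB h (suc i) = CbVValue-renB suc (h i)

mutual
  CbV-subB : ∀ {m n} {σ : Fin m → Bang n} → (∀ i → CbVValue (σ i)) →
             ∀ {T} → CbV T → CbV (subB σ T)
  CbV-subB h (var {i}) = CbVValue⇒CbV (h i)
  CbV-subB h (lam c)   = lam (CbV-subB (CbVValue-extsB h) c)
  CbV-subB h (app c d) = app (CbV-subB h c) (CbV-subB h d)
  CbV-subB h (der c)   = der (CbV-subB h c)
  CbV-subB h (! v)     = ! CbVValue-subB h v

  CbVValue-subB : ∀ {m n} {σ : Fin m → Bang n} → (∀ i → CbVValue (σ i)) →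
                  ∀ {T} → CbVValue T → CbVValue (subB σ T)
  CbVValue-subB h (var {i}) = h i
  CbVValue-subB h (lam c)   = lam (CbV-subB (CbVValue-extsB h) c)

-- Only the fragment CbV is stable: outside it, erasing a v-step can give a
-- β-step whose argument is not a value.
erase-→b : ∀ {n} {T T' : Bang n} → CbV T → T →b T' → CbV T' × (erase T ≃βv erase T')
erase-→b (app (lam c) (! v)) (βv {T} {S}) =
  CbV-subB (λ { zero → v ; (suc i) → var }) c ,
  subst (app (lam (erase T)) (erase S) ≃βv_) (sym (erase-[]B T S))
        (EqClosure.return (βv (erase-CbVValue v)))
erase-→b (der (! v)) βd = CbVValue⇒CbV v , ε
erase-→b (lam c) (ξlam r) with erase-→b c r
... | c' , e = lam c' , EqClosure.gmap lam ξlam e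
erase-→b (app c d) (ξl r) with erase-→b c r
... | c' , e = app c' d , EqClosure.gmap (λ t → app t _) ξl e
erase-→b (app c d) (ξr r) with erase-→b d r
... | d' , e = app c d' , EqClosure.gmap (app _) ξr e
erase-→b (der c) (ξder r) with erase-→b c r
... | c' , e = der c' , e
erase-→b (! lam c) (ξ! (ξlam r)) with erase-→b c r
... | c' , e = ! lam c' , EqClosure.gmap lam ξlam e

erase-→b* : ∀ {n} {T T' : Bang n} → CbV T → T →b* T' → erase T ≃βv erase T'
erase-→b* c ε = ε
erase-→b* c (r ◅ rs) with erase-→b c r
... | c' , e = e ◅◅ erase-→b* c' rs

ᵛ-reflects-≃b : ∀ {n} {t s : Λ n} → (t ᵛ) ≃b (s ᵛ) → t ≃βv s
ᵛ-reflects-≃b {t = t} {s} e with confluent⇒church-rosser →b-confluent e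
... | U , tᵛ↠U , sᵛ↠U =
  subst₂ _≃βv_ (erase-ᵛ t) (erase-ᵛ s)
    (erase-→b* (CbV-ᵛ t) tᵛ↠U ◅◅ EqClosure.symmetric _→βv_ (erase-→b* (CbV-ᵛ s) sᵛ↠U))

corollary13 : (n : ℕ) (t s : Λ n) → (t ≃βv s) ⇔ ((t ᵛ) ≃b (s ᵛ))
corollary13 n t s = mk⇔ ᵛ-preserves-≃βv ᵛ-reflects-≃b
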